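{- Let $d\ge 10$ be an integer, let $p\ge d$ be a prime with $p\equiv 3\pmod 8$ if $d$ is even, let $\kappa=\log_d p$ and let $q>\max\{p^8,120^\kappa p\}$ be a prime. With $D(d)$ and $\bar\mu_q$ as in the context, put $D_{p,q}=\bar\mu_q(D(d))\subset PGL_2(\mathbb F_q)$. Then $|D_{p,q}|=|D(d)|=d+1$.
   Context: $\mathbb H(\mathbb Z)$ denotes the Hamilton integral quaternions ($i^2=j^2=k^2=-1$, $k=ij=-ji$); for $\alpha=a_0+a_1i+a_2j+a_3k$, $\bar\alpha=a_0-a_1i-a_2j-a_3k$, $N(\alpha)=a_0^2+a_1^2+a_2^2+a_3^2$, and $\alpha$ is primitive if $\gcd(a_0,\dots,a_3)=1$. For odd prime $p$: if $p\equiv1\pmod4$, $\mathcal P(p)$ is the set of primitive $\pi$ with $N(\pi)=p$, $\pi_0>0$, $\pi-1\in2\mathbb H(\mathbb Z)$; if $p\equiv3\pmod4$, $\mathcal P(p)$ is the set of primitive $\pi$ with $N(\pi)=p$, $\pi_0>0$ if $\pi_0\ne0$ or $\pi_1>0$ if $\pi_0=0$, and $\pi-i-j-k\in2\mathbb H(\mathbb Z)$. $D(d)\subset\mathcal P(p)$ is a subset of cardinality $d+1$ such that for each $\pi\in D(d)$, $\bar\pi\in D(d)$ iff $\bar\pi\in\mathcal P(p)$. Fix $x,y\in\mathbb F_q$ with $x^2+y^2+1=0$ and let $\phi:\mathbb H(\mathbb F_q)\to M_2(\mathbb F_q)$ be the algebra isomorphism $\alpha_0+\alpha_1i+\alpha_2j+\alpha_3k\mapsto\begin{pmatrix}\alpha_0+\alpha_1x+\alpha_3y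 & -\alpha_1y+\alpha_2+\alpha_3x\\ -\alpha_1y-\alpha_2+\alpha_3x & \alpha_0-\alpha_1x-\alpha_3y\end{pmatrix}$. For $\alpha\in\mathbb H(\mathbb Z)$ with $q\nmid N(\alpha)$, $\bar\mu_q(\alpha)$ is the class in $PGL_2(\mathbb F_q)$ of $\phi(\alpha\bmod q)$. -}

module Defs where

open import Data.Nat as ℕ using (ℕ; _≤_; _<_; _^_; _%_)
open import Data.Nat.Primality using (Prime)
open import Data.Integer as ℤ using (ℤ; +_; _+_; _-_; _*_; -_)
open import Data.Integer.Divisibility using () renaming (_∣_ to _∣ℤ_)
open import Data.Nat.Divisibility using () renaming (_∣_ to _∣ℕ_)
open import Data.Product using (Σ; _×_; ∃; ∃₂)
open import Data.Sum using (_⊎_)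
open import Data.List using (List; length; map)
open import Data.List.Membership.Propositional using (_∈_)
open import Data.List.Relation.Unary.All using (All)
open import Data.List.Relation.Unary.AllPairs using (AllPairs)
open import Data.List.Relation.Unary.Unique.Propositional using (Unique)
open import Relation.Nullary using (¬_)
open import Relation.Binary.PropositionalEquality using (_≡_)
open import Function.Bundles using (_⇔_)

-- Hamilton integral quaternions a0 + a1 i + a2 j + a3 k
record Quat : Set where
  constructor quat
  field
    a0 a1 a2 a3 : ℤ
open Quat public

conj : Quat → Quat
conj (quat a b c d) = quat a (- b) (- c) (- d)

Nrm : Quat → ℤ
Nrm (quat a b c d) = a * a + b * b + c * c + d * d

Primitive : Quat → Set
Primitive (quat a b c d) =
  ∀ (n : ℕ) → n ∣ℕ ℤ.∣ a ∣ → n ∣ℕ ℤ.∣ b ∣ → n ∣ℕ ℤ.∣ c ∣ → n ∣ℕ ℤ.∣ d ∣ → n ≡ 1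

Even : ℤ → Set
Even z = (+ 2) ∣ℤ z

Odd : ℤ → Set
Odd z = ¬ Even z

InP : ℕ → Quat → Set
InP p π@(quat a b c d) =
  Primitive π × Nrm π ≡ + p ×
  ( (p % 4 ≡ 1 × ℤ.0ℤ ℤ.< a × Even (a - ℤ.1ℤ) × Even b × Even c × Even d)
  ⊎ (p % 4 ≡ 3 × ((ℤ.0ℤ ℤ.< a) ⊎ (a ≡ ℤ.0ℤ × ℤ.0ℤ ℤ.< b))
         × Even a × Even (b - ℤ.1ℤ) × Even (c - ℤ.1ℤ) × Even (d - ℤ.1ℤ)) )

IsDd : ℕ → ℕ → List Quat → Set
IsDd d p D =
  Unique D × length D ≡ ℕ.suc d × All (InP p) D ×
  All (λ π → (conj π ∈ D) ⇔ InP p (conj π)) D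

-- 2×2 integer matrices (entries read mod q)
record Mat2 : Set where
  constructor mat
  field
    m11 m12 m21 m22 : ℤ

-- φ applied to α mod q, with x, y integers representing elements of 𝔽_q
φ : ℤ → ℤ → Quat → Mat2
φ x y (quat a0 a1 a2 a3) =
  mat (a0 + a1 * x + a3 * y) (- (a1 * y) + a2 + a3 * x)
      (- (a1 * y) - a2 + a3 * x) (a0 - a1 * x - a3 * y)

PGLEq : ℕ → Mat2 → Mat2 → Set
PGLEq q (mat a b c d) (mat a' b' c' d') =
  Σ ℤ λ l → ¬ ((+ q) ∣ℤ l) ×
    (+ q) ∣ℤ (a - l * a') × (+ q) ∣ℤ (b - l * b') ×
    (+ q) ∣ℤ (c - l * c') × (+ q) ∣ℤ (d - l * d')

-- the real condition q > 120^κ p with κ = log_d p, expressed in integers: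
-- equivalent to log_d 120 < log_p (q/p), i.e. a rational m/n strictly between
BigQ : ℕ → ℕ → ℕ → Set
BigQ d p q = Σ ℕ λ m → Σ ℕ λ n → 1 ≤ n × 120 ^ n < d ^ m × p ^ (m ℕ.+ n) < q ^ n

-- |μ̄_q(D)| = |D|: the classes μ̄_q(π), π ∈ D, are pairwise distinct in PGL₂(𝔽_q)
DistinctImage : ℕ → ℤ → ℤ → List Quat → Set
DistinctImage q x y D = AllPairs (λ α β → ¬ PGLEq q (φ x y α) (φ x y β)) D

-- If φ(α) and φ(β) agree in PGL₂(𝔽_q), then α ≡ λβ (mod q) because φ is an isomorphism mod q.
-- Multiplying on the right by β̄ shows that q divides the imaginary part of αβ̄; as
-- N(αβ̄) = N(α)N(β) = p² < q², that imaginary part vanishes, so αβ̄ = ±p and then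
-- N(α ∓ β) = 2p ∓ 2 Re(αβ̄) = 0, i.e. α = ±β. The sign normalisation of 𝒫(p) excludes α = −β.
module Submission where

open import Defs
open import Data.Integer.Tactic.RingSolver using (solve-∀)
open import Data.Nat as ℕ using (ℕ; suc; z≤n; s≤s; _≤_; _<_; _^_; _%_)
import Data.Nat.Properties as ℕP
open import Data.Nat.Primality using (Prime; euclidsLemma; prime⇒nonZero)
open import Data.Nat.Divisibility using (∣⇒≤) renaming (_∣_ to _∣ℕ_)
open import Data.Integer as ℤ using (ℤ; +_; -[1+_]; _+_; _*_; _-_; -_; 0ℤ)
import Data.Integer.Properties as ℤP
open import Data.Integer.Divisibility using () renaming (_∣_ to _∣ℤ_)
open import Data.Integer.Divisibility.Signed
  using (_∣_; divides; ∣ᵤ⇒∣; ∣⇒∣ᵤ; ∣m∣n⇒∣m+n; ∣m∣n⇒∣m-n; ∣m⇒∣m*n)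
open import Data.List using (List)
open import Data.List.Relation.Unary.All as All using (All; []; _∷_)
open import Data.List.Relation.Unary.AllPairs using (AllPairs; []; _∷_)
open import Data.Product using (Σ; _×_; _,_; proj₁; proj₂)
open import Data.Sum using (_⊎_; inj₁; inj₂; [_,_]′)
open import Data.Empty using (⊥-elim)
open import Relation.Nullary using (¬_)
open import Relation.Binary.PropositionalEquality
open import Relation.Binary.Definitions using (tri<; tri≈; tri>)
open ≡-Reasoning

infixl 7 _·_ _•_ _•ᴹ_
infixl 6 _-ᴴ_ _-ᴹ_
infix 8 -ᴴ_

0ᴴ : Quat
0ᴴ = quat 0ℤ 0ℤ 0ℤ 0ℤ

_·_ : Quat → Quat → Quat
quat a0 a1 a2 a3 · quat b0 b1 b2 b3 =
  quat (a0 * b0 - a1 * b1 - a2 * b2 - a3 * b3)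
       (a0 * b1 + a1 * b0 + a2 * b3 - a3 * b2)
       (a0 * b2 - a1 * b3 + a2 * b0 + a3 * b1)
       (a0 * b3 + a1 * b2 - a2 * b1 + a3 * b0)

_•_ : ℤ → Quat → Quat
l • quat a0 a1 a2 a3 = quat (l * a0) (l * a1) (l * a2) (l * a3)

_-ᴴ_ : Quat → Quat → Quat
quat a0 a1 a2 a3 -ᴴ quat b0 b1 b2 b3 = quat (a0 - b0) (a1 - b1) (a2 - b2) (a3 - b3)

-ᴴ_ : Quat → Quat
-ᴴ quat a0 a1 a2 a3 = quat (- a0) (- a1) (- a2) (- a3)

Im : Quat → Quat
Im (quat _ a1 a2 a3) = quat 0ℤ a1 a2 a3

quat-≡ : ∀ {a b c d a′ b′ c′ d′} → a ≡ a′ → b ≡ b′ → c ≡ c′ → d ≡ d′ →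
         quat a b c d ≡ quat a′ b′ c′ d′
quat-≡ refl refl refl refl = refl

_•ᴹ_ : ℤ → Mat2 → Mat2
l •ᴹ mat a b c d = mat (l * a) (l * b) (l * c) (l * d)

_-ᴹ_ : Mat2 → Mat2 → Mat2
mat a b c d -ᴹ mat a′ b′ c′ d′ = mat (a - a′) (b - b′) (c - c′) (d - d′)

mat-≡ : ∀ {a b c d a′ b′ c′ d′} → a ≡ a′ → b ≡ b′ → c ≡ c′ → d ≡ d′ →
        mat a b c d ≡ mat a′ b′ c′ d′
mat-≡ refl refl refl refl = refl

-- The ring solver does not unfold definitions, so its identities are stated on expanded polynomials.
Nrm-· : ∀ α β → Nrm (α · β) ≡ Nrm α * Nrm β
Nrm-· (quat a0 a1 a2 a3) (quat b0 b1 b2 b3) = four-squares a0 a1 a2 a3 b0 b1 b2 b3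
  where
  four-squares : ∀ a0 a1 a2 a3 b0 b1 b2 b3 →
    (a0 * b0 - a1 * b1 - a2 * b2 - a3 * b3) * (a0 * b0 - a1 * b1 - a2 * b2 - a3 * b3)
    + (a0 * b1 + a1 * b0 + a2 * b3 - a3 * b2) * (a0 * b1 + a1 * b0 + a2 * b3 - a3 * b2)
    + (a0 * b2 - a1 * b3 + a2 * b0 + a3 * b1) * (a0 * b2 - a1 * b3 + a2 * b0 + a3 * b1)
    + (a0 * b3 + a1 * b2 - a2 * b1 + a3 * b0) * (a0 * b3 + a1 * b2 - a2 * b1 + a3 * b0)
    ≡ (a0 * a0 + a1 * a1 + a2 * a2 + a3 * a3) * (b0 * b0 + b1 * b1 + b2 * b2 + b3 * b3)
  four-squares = solve-∀

neg-square : ∀ a → - a * - a ≡ a * a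
neg-square = solve-∀

Nrm-conj : ∀ α → Nrm (conj α) ≡ Nrm α
Nrm-conj (quat a0 a1 a2 a3)
  rewrite neg-square a1 | neg-square a2 | neg-square a3 = refl

Nrm-neg : ∀ α → Nrm (-ᴴ α) ≡ Nrm α
Nrm-neg (quat a0 a1 a2 a3)
  rewrite neg-square a0 | neg-square a1 | neg-square a2 | neg-square a3 = refl

Nrm-sub : ∀ α β → Nrm (α -ᴴ β) ≡ Nrm α + Nrm β - + 2 * a0 (α · conj β)
Nrm-sub (quat a0 a1 a2 a3) (quat b0 b1 b2 b3) = identity a0 a1 a2 a3 b0 b1 b2 b3
  where
  identity : ∀ a0 a1 a2 a3 b0 b1 b2 b3 →
    (a0 - b0) * (a0 - b0) + (a1 - b1) * (a1 - b1) + (a2 - b2) * (a2 - b2) + (a3 - b3) * (a3 - b3)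
    ≡ (a0 * a0 + a1 * a1 + a2 * a2 + a3 * a3) + (b0 * b0 + b1 * b1 + b2 * b2 + b3 * b3)
      - + 2 * (a0 * b0 - a1 * - b1 - a2 * - b2 - a3 * - b3)
  identity = solve-∀

Re-·-conj-neg : ∀ α β → a0 (α · conj (-ᴴ β)) ≡ - a0 (α · conj β)
Re-·-conj-neg (quat a0 a1 a2 a3) (quat b0 b1 b2 b3) = identity a0 a1 a2 a3 b0 b1 b2 b3
  where
  identity : ∀ a0 a1 a2 a3 b0 b1 b2 b3 →
    a0 * - b0 - a1 * - - b1 - a2 * - - b2 - a3 * - - b3
    ≡ - (a0 * b0 - a1 * - b1 - a2 * - b2 - a3 * - b3)
  identity = solve-∀

Im-·-conj : ∀ α β l → Im ((α -ᴴ l • β) · conj β) ≡ Im (α · conj β)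
Im-·-conj (quat a0 a1 a2 a3) (quat b0 b1 b2 b3) l =
  quat-≡ refl (i-part a0 a1 a2 a3 b0 b1 b2 b3 l) (j-part a0 a1 a2 a3 b0 b1 b2 b3 l)
              (k-part a0 a1 a2 a3 b0 b1 b2 b3 l)
  where
  i-part : ∀ a0 a1 a2 a3 b0 b1 b2 b3 l →
    (a0 - l * b0) * - b1 + (a1 - l * b1) * b0 + (a2 - l * b2) * - b3 - (a3 - l * b3) * - b2
    ≡ a0 * - b1 + a1 * b0 + a2 * - b3 - a3 * - b2
  i-part = solve-∀
  j-part : ∀ a0 a1 a2 a3 b0 b1 b2 b3 l →
    (a0 - l * b0) * - b2 - (a1 - l * b1) * - b3 + (a2 - l * b2) * b0 + (a3 - l * b3) * - b1
    ≡ a0 * - b2 - a1 * - b3 + a2 * b0 + a3 * - b1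
  j-part = solve-∀
  k-part : ∀ a0 a1 a2 a3 b0 b1 b2 b3 l →
    (a0 - l * b0) * - b3 + (a1 - l * b1) * - b2 - (a2 - l * b2) * - b1 + (a3 - l * b3) * b0
    ≡ a0 * - b3 + a1 * - b2 - a2 * - b1 + a3 * b0
  k-part = solve-∀

φ-linear : ∀ x y α β l → φ x y (α -ᴴ l • β) ≡ φ x y α -ᴹ l •ᴹ φ x y β
φ-linear x y (quat a0 a1 a2 a3) (quat b0 b1 b2 b3) l =
  mat-≡ (entry₁₁ a0 a1 a3 b0 b1 b3 l x y) (entry₁₂ a1 a2 a3 b1 b2 b3 l x y)
        (entry₂₁ a1 a2 a3 b1 b2 b3 l x y) (entry₂₂ a0 a1 a3 b0 b1 b3 l x y)
  where
  entry₁₁ : ∀ a0 a1 a3 b0 b1 b3 l x y →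
    (a0 - l * b0) + (a1 - l * b1) * x + (a3 - l * b3) * y
    ≡ (a0 + a1 * x + a3 * y) - l * (b0 + b1 * x + b3 * y)
  entry₁₁ = solve-∀
  entry₁₂ : ∀ a1 a2 a3 b1 b2 b3 l x y →
    - ((a1 - l * b1) * y) + (a2 - l * b2) + (a3 - l * b3) * x
    ≡ (- (a1 * y) + a2 + a3 * x) - l * (- (b1 * y) + b2 + b3 * x)
  entry₁₂ = solve-∀
  entry₂₁ : ∀ a1 a2 a3 b1 b2 b3 l x y →
    - ((a1 - l * b1) * y) - (a2 - l * b2) + (a3 - l * b3) * x
    ≡ (- (a1 * y) - a2 + a3 * x) - l * (- (b1 * y) - b2 + b3 * x)
  entry₂₁ = solve-∀
  entry₂₂ : ∀ a0 a1 a3 b0 b1 b3 l x y →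
    (a0 - l * b0) - (a1 - l * b1) * x - (a3 - l * b3) * y
    ≡ (a0 - a1 * x - a3 * y) - l * (b0 - b1 * x - b3 * y)
  entry₂₂ = solve-∀

infix 4 _∣ᴴ_ _∣ᴹ_

_∣ᴴ_ : ℤ → Quat → Set
k ∣ᴴ quat a0 a1 a2 a3 = k ∣ a0 × k ∣ a1 × k ∣ a2 × k ∣ a3

_∣ᴹ_ : ℤ → Mat2 → Set
k ∣ᴹ mat a b c d = k ∣ a × k ∣ b × k ∣ c × k ∣ d

module _ {k : ℤ} where
  infixl 6 _⊕_ _⊖_
  infixl 7 _⊛_

  _⊕_ : ∀ {m n} → k ∣ m → k ∣ n → k ∣ m + n
  _⊕_ = ∣m∣n⇒∣m+n

  _⊖_ : ∀ {m n} → k ∣ m → k ∣ n → k ∣ m - n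
  _⊖_ = ∣m∣n⇒∣m-n

  _⊛_ : ∀ {m} → k ∣ m → ∀ n → k ∣ m * n
  k∣m ⊛ n = ∣m⇒∣m*n n k∣m

∣ᴴ-·ʳ : ∀ {k} α β → k ∣ᴴ α → k ∣ᴴ α · β
∣ᴴ-·ʳ (quat _ _ _ _) (quat b0 b1 b2 b3) (d0 , d1 , d2 , d3) =
  d0 ⊛ b0 ⊖ d1 ⊛ b1 ⊖ d2 ⊛ b2 ⊖ d3 ⊛ b3 ,
  d0 ⊛ b1 ⊕ d1 ⊛ b0 ⊕ d2 ⊛ b3 ⊖ d3 ⊛ b2 ,
  d0 ⊛ b2 ⊖ d1 ⊛ b3 ⊕ d2 ⊛ b0 ⊕ d3 ⊛ b1 ,
  d0 ⊛ b3 ⊕ d1 ⊛ b2 ⊖ d2 ⊛ b1 ⊕ d3 ⊛ b0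

∣ᴴ-Im : ∀ {k} α → k ∣ᴴ α → k ∣ᴴ Im α
∣ᴴ-Im (quat _ _ _ _) (_ , d1 , d2 , d3) = divides 0ℤ refl , d1 , d2 , d3

odd-prime-∣2*⇒∣ : ∀ {q e} → Prime q → 2 < q → + q ∣ + 2 * e → + q ∣ e
odd-prime-∣2*⇒∣ {q} {e} q-prime 2<q q∣2e
  with euclidsLemma 2 ℤ.∣ e ∣ q-prime (subst (q ∣ℕ_) (ℤP.abs-* (+ 2) e) (∣⇒∣ᵤ q∣2e))
... | inj₁ q∣2 = ⊥-elim (ℕP.<⇒≱ 2<q (∣⇒≤ q∣2))
... | inj₂ q∣e = ∣ᵤ⇒∣ q∣e

-- φ is inverted mod q using that 2 is invertible and x² + y² ≡ −1.
φ-kernel : ∀ {q x y} → Prime q → 2 < q → + q ∣ (x * x + y * y + + 1) →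
           ∀ γ → + q ∣ᴹ φ x y γ → + q ∣ᴴ γ
φ-kernel {q} {x} {y} q-prime 2<q q∣x²+y²+1 (quat e0 e1 e2 e3) (q∣m₁₁ , q∣m₁₂ , q∣m₂₁ , q∣m₂₂) =
  halve (twice-e0 e0 e1 e3 x y) (q∣m₁₁ ⊕ q∣m₂₂) ,
  halve (twice-e1 e0 e1 e2 e3 x y)
        (q∣x²+y²+1 ⊛ (+ 2 * e1) ⊖ (q∣m₁₁ ⊖ q∣m₂₂) ⊛ x ⊕ (q∣m₁₂ ⊕ q∣m₂₁) ⊛ y) ,
  halve (twice-e2 e1 e2 e3 x y) (q∣m₁₂ ⊖ q∣m₂₁) ,
  halve (twice-e3 e0 e1 e2 e3 x y)
        (q∣x²+y²+1 ⊛ (+ 2 * e3) ⊖ (q∣m₁₁ ⊖ q∣m₂₂) ⊛ y ⊖ (q∣m₁₂ ⊕ q∣m₂₁) ⊛ x)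
  where
  halve : ∀ {e t} → + 2 * e ≡ t → + q ∣ t → + q ∣ e
  halve 2e≡t q∣t = odd-prime-∣2*⇒∣ q-prime 2<q (subst (+ q ∣_) (sym 2e≡t) q∣t)
  twice-e0 : ∀ e0 e1 e3 x y →
    + 2 * e0 ≡ (e0 + e1 * x + e3 * y) + (e0 - e1 * x - e3 * y)
  twice-e0 = solve-∀
  twice-e1 : ∀ e0 e1 e2 e3 x y →
    + 2 * e1 ≡ (x * x + y * y + + 1) * (+ 2 * e1)
               - ((e0 + e1 * x + e3 * y) - (e0 - e1 * x - e3 * y)) * x
               + ((- (e1 * y) + e2 + e3 * x) + (- (e1 * y) - e2 + e3 * x)) * y
  twice-e1 = solve-∀
  twice-e2 : ∀ e1 e2 e3 x y →
    + 2 * e2 ≡ (- (e1 * y) + e2 + e3 * x) - (- (e1 * y) - e2 + e3 * x)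
  twice-e2 = solve-∀
  twice-e3 : ∀ e0 e1 e2 e3 x y →
    + 2 * e3 ≡ (x * x + y * y + + 1) * (+ 2 * e3)
               - ((e0 + e1 * x + e3 * y) - (e0 - e1 * x - e3 * y)) * y
               - ((- (e1 * y) + e2 + e3 * x) + (- (e1 * y) - e2 + e3 * x)) * x
  twice-e3 = solve-∀

-- The scalar of a PGL₂ equality is a unit mod q, but the argument never needs that.
PGLEq⇒∣ᴹ : ∀ {q} A B → PGLEq q A B → Σ ℤ λ l → + q ∣ᴹ A -ᴹ l •ᴹ B
PGLEq⇒∣ᴹ _ _ (l , _ , q∣m₁₁ , q∣m₁₂ , q∣m₂₁ , q∣m₂₂) =
  l , ∣ᵤ⇒∣ q∣m₁₁ , ∣ᵤ⇒∣ q∣m₁₂ , ∣ᵤ⇒∣ q∣m₂₁ , ∣ᵤ⇒∣ q∣m₂₂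

PGLEq-φ⇒∣ᴴ-Im : ∀ {q x y} → Prime q → 2 < q → + q ∣ (x * x + y * y + + 1) →
                ∀ α β → PGLEq q (φ x y α) (φ x y β) → + q ∣ᴴ Im (α · conj β)
PGLEq-φ⇒∣ᴴ-Im {q} {x} {y} q-prime 2<q q∣x²+y²+1 α β φα~φβ
  with PGLEq⇒∣ᴹ (φ x y α) (φ x y β) φα~φβ
... | l , q∣φα-lφβ = subst (+ q ∣ᴴ_) (Im-·-conj α β l)
  (∣ᴴ-Im ((α -ᴴ l • β) · conj β) (∣ᴴ-·ʳ (α -ᴴ l • β) (conj β) q∣α-lβ))
  where
  q∣α-lβ : + q ∣ᴴ α -ᴴ l • β
  q∣α-lβ = φ-kernel q-prime 2<q q∣x²+y²+1 (α -ᴴ l • β)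
             (subst (+ q ∣ᴹ_) (sym (φ-linear x y α β l)) q∣φα-lφβ)

sq : ℤ → ℕ
sq z = ℤ.∣ z ∣ ℕ.* ℤ.∣ z ∣

Nrmℕ : Quat → ℕ
Nrmℕ (quat a0 a1 a2 a3) = sq a0 ℕ.+ sq a1 ℕ.+ sq a2 ℕ.+ sq a3

*-self≡+sq : ∀ z → z * z ≡ + sq z
*-self≡+sq (+ n) = sym (ℤP.pos-* n n)
*-self≡+sq -[1+ n ] = refl

Nrm≡+Nrmℕ : ∀ γ → Nrm γ ≡ + Nrmℕ γ
Nrm≡+Nrmℕ (quat a0 a1 a2 a3) = begin
  a0 * a0 + a1 * a1 + a2 * a2 + a3 * a3
    ≡⟨ cong₂ _+_ (cong₂ _+_ (cong₂ _+_ (*-self≡+sq a0) (*-self≡+sq a1)) (*-self≡+sq a2))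
                 (*-self≡+sq a3) ⟩
  + sq a0 + + sq a1 + + sq a2 + + sq a3
    ≡⟨ cong (λ t → t + + sq a2 + + sq a3) (ℤP.pos-+ (sq a0) (sq a1)) ⟨
  + (sq a0 ℕ.+ sq a1) + + sq a2 + + sq a3
    ≡⟨ cong (_+ + sq a3) (ℤP.pos-+ (sq a0 ℕ.+ sq a1) (sq a2)) ⟨
  + (sq a0 ℕ.+ sq a1 ℕ.+ sq a2) + + sq a3
    ≡⟨ ℤP.pos-+ (sq a0 ℕ.+ sq a1 ℕ.+ sq a2) (sq a3) ⟨
  + Nrmℕ (quat a0 a1 a2 a3) ∎

sq≡0⇒≡0 : ∀ z → sq z ≡ 0 → z ≡ 0ℤ
sq≡0⇒≡0 z sq≡0 =
  [ ℤP.∣i∣≡0⇒i≡0 , ℤP.∣i∣≡0⇒i≡0 ]′ (ℕP.m*n≡0⇒m≡0∨n≡0 ℤ.∣ z ∣ sq≡0)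

Nrmℕ≡0⇒≡0ᴴ : ∀ γ → Nrmℕ γ ≡ 0 → γ ≡ 0ᴴ
Nrmℕ≡0⇒≡0ᴴ (quat a0 a1 a2 a3) N≡0 =
  quat-≡ (sq≡0⇒≡0 a0 (ℕP.m+n≡0⇒m≡0 _ s₀₁≡0)) (sq≡0⇒≡0 a1 (ℕP.m+n≡0⇒n≡0 _ s₀₁≡0))
         (sq≡0⇒≡0 a2 (ℕP.m+n≡0⇒n≡0 _ s₀₁₂≡0)) (sq≡0⇒≡0 a3 (ℕP.m+n≡0⇒n≡0 _ N≡0))
  where
  s₀₁₂≡0 = ℕP.m+n≡0⇒m≡0 _ N≡0
  s₀₁≡0 = ℕP.m+n≡0⇒m≡0 _ s₀₁₂≡0

Nrmℕ-Im-≤ : ∀ γ → Nrmℕ (Im γ) ≤ Nrmℕ γ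
Nrmℕ-Im-≤ (quat _ a1 a2 a3) =
  ℕP.+-monoˡ-≤ (sq a3) (ℕP.+-monoˡ-≤ (sq a2) (ℕP.+-monoˡ-≤ (sq a1) z≤n))

∣ᴴ∧Nrmℕ<⇒≡0ᴴ : ∀ {m} γ → + m ∣ᴴ γ → Nrmℕ γ < m ℕ.* m → γ ≡ 0ᴴ
∣ᴴ∧Nrmℕ<⇒≡0ᴴ {m} _ (divides k0 refl , divides k1 refl , divides k2 refl , divides k3 refl) N<m² =
  cong (λ δ → quat (a0 δ * + m) (a1 δ * + m) (a2 δ * + m) (a3 δ * + m))
       (Nrmℕ≡0⇒≡0ᴴ κ (m²*n<m²⇒n≡0 (Nrmℕ κ) (subst (_< m ℕ.* m) Nrmℕ-scaled N<m²)))
  where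
  κ = quat k0 k1 k2 k3
  scaled : ∀ k0 k1 k2 k3 m →
    k0 * m * (k0 * m) + k1 * m * (k1 * m) + k2 * m * (k2 * m) + k3 * m * (k3 * m)
    ≡ m * m * (k0 * k0 + k1 * k1 + k2 * k2 + k3 * k3)
  scaled = solve-∀
  Nrmℕ-scaled : Nrmℕ (quat (k0 * + m) (k1 * + m) (k2 * + m) (k3 * + m)) ≡ m ℕ.* m ℕ.* Nrmℕ κ
  Nrmℕ-scaled = ℤP.+-injective (begin
    + Nrmℕ (quat (k0 * + m) (k1 * + m) (k2 * + m) (k3 * + m))
      ≡⟨ Nrm≡+Nrmℕ (quat (k0 * + m) (k1 * + m) (k2 * + m) (k3 * + m)) ⟨
    Nrm (quat (k0 * + m) (k1 * + m) (k2 * + m) (k3 * + m))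
      ≡⟨ scaled k0 k1 k2 k3 (+ m) ⟩
    + m * + m * Nrm κ
      ≡⟨ cong₂ _*_ (ℤP.pos-* m m) (sym (Nrm≡+Nrmℕ κ)) ⟨
    + (m ℕ.* m) * + Nrmℕ κ
      ≡⟨ ℤP.pos-* (m ℕ.* m) (Nrmℕ κ) ⟨
    + (m ℕ.* m ℕ.* Nrmℕ κ) ∎)
  m²*n<m²⇒n≡0 : ∀ n → m ℕ.* m ℕ.* n < m ℕ.* m → n ≡ 0
  m²*n<m²⇒n≡0 0 _ = refl
  m²*n<m²⇒n≡0 (suc n) m²n<m² = ⊥-elim (ℕP.<⇒≱ m²n<m² (ℕP.m≤m*n (m ℕ.* m) (suc n)))

m*m≡n*n⇒m≡n : ∀ m n → m ℕ.* m ≡ n ℕ.* n → m ≡ n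
m*m≡n*n⇒m≡n m n m²≡n² with ℕP.<-cmp m n
... | tri< m<n _ _ = ⊥-elim (ℕP.<-irrefl m²≡n² (ℕP.*-mono-< m<n m<n))
... | tri≈ _ m≡n _ = m≡n
... | tri> _ _ n<m = ⊥-elim (ℕP.<-irrefl (sym m²≡n²) (ℕP.*-mono-< n<m n<m))

sq≡n*n⇒≡± : ∀ z n → sq z ≡ n ℕ.* n → z ≡ + n ⊎ z ≡ - + n
sq≡n*n⇒≡± (+ m) n m²≡n² = inj₁ (cong +_ (m*m≡n*n⇒m≡n m n m²≡n²))
sq≡n*n⇒≡± -[1+ m ] n m²≡n² = inj₂ (cong (λ k → - + k) (m*m≡n*n⇒m≡n (suc m) n m²≡n²))

Im≡0ᴴ⇒Nrmℕ≡sq-Re : ∀ γ → Im γ ≡ 0ᴴ → Nrmℕ γ ≡ sq (a0 γ)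
Im≡0ᴴ⇒Nrmℕ≡sq-Re (quat r _ _ _) refl =
  trans (ℕP.+-identityʳ _) (trans (ℕP.+-identityʳ _) (ℕP.+-identityʳ (sq r)))

-ᴴ≡0ᴴ⇒≡ : ∀ α β → α -ᴴ β ≡ 0ᴴ → α ≡ β
-ᴴ≡0ᴴ⇒≡ (quat a0 a1 a2 a3) (quat b0 b1 b2 b3) α-β≡0 =
  quat-≡ (ℤP.i-j≡0⇒i≡j a0 b0 (cong Quat.a0 α-β≡0)) (ℤP.i-j≡0⇒i≡j a1 b1 (cong Quat.a1 α-β≡0))
         (ℤP.i-j≡0⇒i≡j a2 b2 (cong Quat.a2 α-β≡0)) (ℤP.i-j≡0⇒i≡j a3 b3 (cong Quat.a3 α-β≡0))

Re-·-conj≡Nrm⇒≡ : ∀ {n} α β → Nrm α ≡ + n → Nrm β ≡ + n → a0 (α · conj β) ≡ + n → α ≡ β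
Re-·-conj≡Nrm⇒≡ {n} α β Nα≡n Nβ≡n Re≡n =
  -ᴴ≡0ᴴ⇒≡ α β (Nrmℕ≡0⇒≡0ᴴ (α -ᴴ β) (ℤP.+-injective (begin
    + Nrmℕ (α -ᴴ β)                        ≡⟨ Nrm≡+Nrmℕ (α -ᴴ β) ⟨
    Nrm (α -ᴴ β)                           ≡⟨ Nrm-sub α β ⟩
    Nrm α + Nrm β - + 2 * a0 (α · conj β)  ≡⟨ cong₂ (λ s t → s - + 2 * t) (cong₂ _+_ Nα≡n Nβ≡n) Re≡n ⟩
    + n + + n - + 2 * + n                  ≡⟨ cancel (+ n) ⟩
    0ℤ                                     ∎)))
  where
  cancel : ∀ m → m + m - + 2 * m ≡ 0ℤ
  cancel = solve-∀

Nrmℕ-·-conj : ∀ {m n} α β → Nrm α ≡ + m → Nrm β ≡ + n → Nrmℕ (α · conj β) ≡ m ℕ.* n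
Nrmℕ-·-conj {m} {n} α β Nα≡m Nβ≡n = ℤP.+-injective (begin
  + Nrmℕ (α · conj β)   ≡⟨ Nrm≡+Nrmℕ (α · conj β) ⟨
  Nrm (α · conj β)      ≡⟨ Nrm-· α (conj β) ⟩
  Nrm α * Nrm (conj β)  ≡⟨ cong₂ _*_ Nα≡m (trans (Nrm-conj β) Nβ≡n) ⟩
  + m * + n             ≡⟨ ℤP.pos-* m n ⟨
  + (m ℕ.* n)           ∎)

∣ᴴ-Im-·-conj⇒Im≡0ᴴ : ∀ {q n} α β → n < q → Nrm α ≡ + n → Nrm β ≡ + n →
                     + q ∣ᴴ Im (α · conj β) → Im (α · conj β) ≡ 0ᴴ
∣ᴴ-Im-·-conj⇒Im≡0ᴴ {q} α β n<q Nα≡n Nβ≡n q∣Imρ =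
  ∣ᴴ∧Nrmℕ<⇒≡0ᴴ (Im (α · conj β)) q∣Imρ (ℕP.≤-<-trans (Nrmℕ-Im-≤ (α · conj β))
    (subst (ℕ._< q ℕ.* q) (sym (Nrmℕ-·-conj α β Nα≡n Nβ≡n)) (ℕP.*-mono-< n<q n<q)))

∣ᴴ-Im-·-conj⇒Re≡± : ∀ {q n} α β → n < q → Nrm α ≡ + n → Nrm β ≡ + n →
                    + q ∣ᴴ Im (α · conj β) → a0 (α · conj β) ≡ + n ⊎ a0 (α · conj β) ≡ - + n
∣ᴴ-Im-·-conj⇒Re≡± {n = n} α β n<q Nα≡n Nβ≡n q∣Imρ = sq≡n*n⇒≡± (a0 (α · conj β)) n (begin
  sq (a0 (α · conj β))  ≡⟨ Im≡0ᴴ⇒Nrmℕ≡sq-Re (α · conj β)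
                             (∣ᴴ-Im-·-conj⇒Im≡0ᴴ α β n<q Nα≡n Nβ≡n q∣Imρ) ⟨
  Nrmℕ (α · conj β)     ≡⟨ Nrmℕ-·-conj α β Nα≡n Nβ≡n ⟩
  n ℕ.* n               ∎)

Re-·-conj≡±⇒≡± : ∀ {n} α β → Nrm α ≡ + n → Nrm β ≡ + n →
                 a0 (α · conj β) ≡ + n ⊎ a0 (α · conj β) ≡ - + n → α ≡ β ⊎ α ≡ -ᴴ β
Re-·-conj≡±⇒≡± α β Nα≡n Nβ≡n (inj₁ Re≡n) = inj₁ (Re-·-conj≡Nrm⇒≡ α β Nα≡n Nβ≡n Re≡n)
Re-·-conj≡±⇒≡± {n} α β Nα≡n Nβ≡n (inj₂ Re≡-n) =
  inj₂ (Re-·-conj≡Nrm⇒≡ α (-ᴴ β) Nα≡n (trans (Nrm-neg β) Nβ≡n)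
         (trans (Re-·-conj-neg α β) (trans (cong -_ Re≡-n) (ℤP.neg-involutive (+ n)))))

PGLEq-φ⇒≡± : ∀ {q n x y} → Prime q → 2 < q → n < q → + q ∣ (x * x + y * y + + 1) →
             ∀ α β → Nrm α ≡ + n → Nrm β ≡ + n → PGLEq q (φ x y α) (φ x y β) →
             α ≡ β ⊎ α ≡ -ᴴ β
PGLEq-φ⇒≡± q-prime 2<q n<q q∣x²+y²+1 α β Nα≡n Nβ≡n φα~φβ =
  Re-·-conj≡±⇒≡± α β Nα≡n Nβ≡n (∣ᴴ-Im-·-conj⇒Re≡± α β n<q Nα≡n Nβ≡n
    (PGLEq-φ⇒∣ᴴ-Im q-prime 2<q q∣x²+y²+1 α β φα~φβ))

SignNormalised : Quat → Set
SignNormalised γ = 0ℤ ℤ.< a0 γ ⊎ (a0 γ ≡ 0ℤ × 0ℤ ℤ.< a1 γ)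

InP⇒SignNormalised : ∀ {p} γ → InP p γ → SignNormalised γ
InP⇒SignNormalised _ (_ , _ , inj₁ (_ , 0<a0 , _)) = inj₁ 0<a0
InP⇒SignNormalised _ (_ , _ , inj₂ (_ , normalised , _)) = normalised

SignNormalised-¬-ᴴ : ∀ γ → SignNormalised γ → ¬ SignNormalised (-ᴴ γ)
SignNormalised-¬-ᴴ _ (inj₁ 0<a) (inj₁ 0<-a) = ℤP.<-asym 0<-a (ℤP.neg-mono-< 0<a)
SignNormalised-¬-ᴴ _ (inj₁ 0<a) (inj₂ (-a≡0 , _)) = ℤP.<-irrefl -a≡0 (ℤP.neg-mono-< 0<a)
SignNormalised-¬-ᴴ _ (inj₂ (refl , _)) (inj₁ 0<-0) = ℤP.<-irrefl refl 0<-0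
SignNormalised-¬-ᴴ _ (inj₂ (_ , 0<b)) (inj₂ (_ , 0<-b)) = ℤP.<-asym 0<-b (ℤP.neg-mono-< 0<b)

AllPairs-mapWithAll : ∀ {A : Set} {P : A → Set} {R S : A → A → Set} →
                      (∀ {a b} → P a → P b → R a b → S a b) →
                      ∀ {xs} → All P xs → AllPairs R xs → AllPairs S xs
AllPairs-mapWithAll f [] [] = []
AllPairs-mapWithAll f (pa ∷ ps) (ra ∷ rs) =
  All.zipWith (λ (pb , r) → f pa pb r) (ps , ra) ∷ AllPairs-mapWithAll f ps rs

lemma5 : (d p q : ℕ) → 10 ≤ d → Prime p → d ≤ p →
         (2 ∣ℕ d → p % 8 ≡ 3) →
         Prime q → p ^ 8 < q → BigQ d p q →
         (D : List Quat) → IsDd d p D →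
         (x y : ℤ) → (+ q) ∣ℤ (x * x + y * y + + 1) →
         DistinctImage q x y D
lemma5 d p q 10≤d p-prime d≤p _ q-prime p⁸<q _ D (unique , _ , D⊆𝒫 , _) x y q∣x²+y²+1 =
  AllPairs-mapWithAll distinct D⊆𝒫 unique
  where
  p<q : p < q
  p<q = ℕP.≤-<-trans (ℕP.m≤m*n p (p ^ 7) {{ℕP.m^n≢0 p 7 {{prime⇒nonZero p-prime}}}}) p⁸<q
  2<q : 2 < q
  2<q = ℕP.≤-trans (s≤s (s≤s (s≤s z≤n))) (ℕP.≤-trans 10≤d (ℕP.≤-trans d≤p (ℕP.<⇒≤ p<q)))
  distinct : ∀ {α β} → InP p α → InP p β → α ≢ β → ¬ PGLEq q (φ x y α) (φ x y β)
  distinct {α} {β} α∈𝒫 β∈𝒫 α≢β φα~φβ =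
    [ α≢β , (λ α≡-β → SignNormalised-¬-ᴴ β (InP⇒SignNormalised β β∈𝒫)
                        (subst SignNormalised α≡-β (InP⇒SignNormalised α α∈𝒫))) ]′
    (PGLEq-φ⇒≡± q-prime 2<q p<q (∣ᵤ⇒∣ q∣x²+y²+1) α β
       (proj₁ (proj₂ α∈𝒫)) (proj₁ (proj₂ β∈𝒫)) φα~φβ)
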